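{- Let $n\ge4$ and let $\mathcal X$ be a $GC_n$ set of defect $3$, with the notation of the context. Then for every $\{i,j,k\}=\{1,2,3\}$ with $i<j$, the line $\ell_{ij}$ does not pass through the node $D_k$.
   Context: An $n$-correct set: $\binom{n+2}{2}$ points on which interpolation by bivariate polynomials of total degree $\le n$ is uniquely solvable. A $GC_n$ set: an $n$-correct set whose fundamental polynomials are all products of $n$ linear factors. A maximal line contains $n+1$ nodes; the defect is $n+2$ minus the number of maximal lines. A $k_m$-node lies on exactly $k$ maximal lines. Known structure of defect-$3$ $GC_n$ sets ($n\ge4$): there are exactly $n-1$ maximal lines $\lambda_1,\dots,\lambda_{n-1}$, in general position; the nodes are their pairwise intersections ($2_m$-nodes), three further nodes on each $\lambda_i$ ($1_m$-nodes), and three non-collinear $0_m$-nodes $O_1,O_2,O_3$. Let $\ell_i^{oo}$ be the line through the two nodes of $\{O_1,O_2,O_3\}\setminus\{O_i\}$ ($OO$-lines). After a suitable renumbering: (i) the $1_m$-nodes not lying on $\ell_1^{oo}\cup\ell_2^{oo}\cup\ell_3^{oo}$ are exactly three nodes $D_1,D_2,D_3$ with $D_i\in\lambda_i$; (ii) each $\ell_i^{oo}$ contains exactly $n$ nodes ($n-2$ $1_m$-nodes and two $0_m$-nodes) and $\ell_i^{oo}\cap\lambda_i\notin\mathcal X$, $i=1,2,3$; (iii) the triples $\{O_1,D_2,D_3\},\{O_2,D_1,D_3\},\{O_3,D_1,D_2\}$ are collinear, on lines $\ell_1^{dd},\ell_2^{dd},\ell_3^{dd}$ respectively ($DD$-lines).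 For $1\le i<j\le3$ and $k$ the third index, among the six $1_m$-nodes on $\lambda_i\cup\lambda_j$ two lie on $\ell_k^{oo}$ and two ($D_i,D_j$) lie on $\ell_k^{dd}$; $\ell_{ij}$ denotes the line through the remaining two. -}

module Defs where

open import Level using (0ℓ)
open import Data.Nat using (ℕ; zero; suc; _≤_; z≤n; s≤s) renaming (_+_ to _+ℕ_; _∸_ to _∸ℕ_)
open import Data.Nat.Properties using (m≤n+m)
open import Data.Nat.Combinatorics using (_C_)
open import Data.Fin using (Fin; inject≤)
import Data.Fin
open import Data.List using (List; []; _∷_; length)
open import Data.Product using (Σ; ∃; _×_; _,_)
open import Data.Sum using (_⊎_)
open import Relation.Nullary using (¬_)
open import Relation.Binary.PropositionalEquality using (_≡_; _≢_)
open import Algebra.Structures using (IsCommutativeRing)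
open import Relation.Binary.Structures using (IsTotalOrder)

-- Monic univariate polynomial given by its lower coefficients
-- c₀ , … , c_{d-1}  (low to high):  c₀ + x (c₁ + x ( … + x · 1)),
-- i.e. x^d + c_{d-1} x^{d-1} + … + c₀  with d = length cs.

evalMonic : {A : Set} → (A → A → A) → (A → A → A) → A → List A → A → A
evalMonic _+_ _*_ one []       x = one
evalMonic _+_ _*_ one (c ∷ cs) x = c + (x * evalMonic _+_ _*_ one cs x)

-- Real closed fields (first-order axiomatisation).  By Tarski's transfer
-- principle, for each fixed n the statement holds over ℝ iff it holds
-- over every real closed field.

record RealClosedField : Set₁ where
  infixl 6 _+_
  infixl 7 _*_
  field
    Carrier : Set
    _+_ _*_ : Carrier → Carrier → Carrier
    -_      : Carrier → Carrier
    0# 1#   : Carrier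
    _≤F_    : Carrier → Carrier → Set
    isCommutativeRing : IsCommutativeRing _≡_ _+_ _*_ -_ 0# 1#
    0≢1      : 0# ≢ 1#
    inverse  : ∀ x → x ≢ 0# → ∃ λ y → x * y ≡ 1#
    isTotalOrder : IsTotalOrder _≡_ _≤F_
    +-mono-≤ : ∀ x y z → x ≤F y → (x + z) ≤F (y + z)
    *-nonneg : ∀ x y → 0# ≤F x → 0# ≤F y → 0# ≤F (x * y)
    sqrt     : ∀ x → 0# ≤F x → ∃ λ y → y * y ≡ x
    oddRoot  : ∀ (d : ℕ) (cs : List Carrier) → length cs ≡ suc (d +ℕ d) →
               ∃ λ x → evalMonic _+_ _*_ 1# cs x ≡ 0#

module Plane (F : RealClosedField) where
  open RealClosedField F

  Point : Set
  Point = Carrier × Carrier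

  _^_ : Carrier → ℕ → Carrier
  x ^ zero  = 1#
  x ^ suc k = x * (x ^ k)

  sumBelow : ℕ → (ℕ → Carrier) → Carrier
  sumBelow zero    f = 0#
  sumBelow (suc k) f = sumBelow k f + f k

  -- bivariate polynomials of total degree ≤ n: coefficient c i j of x^i y^j
  -- (only the coefficients with i +ℕ j ≤ n matter)
  Poly : Set
  Poly = ℕ → ℕ → Carrier

  eval : ℕ → Poly → Point → Carrier
  eval n c (x , y) =
    sumBelow (suc n) (λ i → sumBelow (suc (n ∸ℕ i)) (λ j → c i j * ((x ^ i) * (y ^ j))))

  record Line : Set where
    constructor line
    field
      a b c : Carrier
      nondeg : ¬ (a ≡ 0# × b ≡ 0#)

  linEval : Line → Point → Carrier
  linEval (line a b c _) (x , y) = a * x + b * y + c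

  OnLine : Line → Point → Set
  OnLine L p = linEval L p ≡ 0#

  SameLine : Line → Line → Set
  SameLine L M = ∀ p → (OnLine L p → OnLine M p) × (OnLine M p → OnLine L p)

  Collinear : Point → Point → Point → Set
  Collinear p q r = ∃ λ L → OnLine L p × OnLine L q × OnLine L r

  prodFin : (k : ℕ) → (Fin k → Carrier) → Carrier
  prodFin zero    f = 1#
  prodFin (suc k) f = f Data.Fin.zero * prodFin k (λ t → f (Data.Fin.suc t))

  dim : ℕ → ℕ
  dim n = (n +ℕ 2) C 2

  Injective : {A B : Set} → (A → B) → Set
  Injective f = ∀ {u v} → f u ≡ f v → u ≡ v

  Correct : (n : ℕ) → (Fin (dim n) → Point) → Set
  Correct n X =
    Injective X ×
    (∀ (v : Fin (dim n) → Carrier) →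
       (∃ λ c → ∀ a → eval n c (X a) ≡ v a) ×
       (∀ c c' → (∀ a → eval n c (X a) ≡ v a) → (∀ a → eval n c' (X a) ≡ v a) →
          ∀ i j → i +ℕ j ≤ n → c i j ≡ c' i j))

  Fundamental : (n : ℕ) → (Fin (dim n) → Point) → Fin (dim n) → Poly → Set
  Fundamental n X a c = eval n c (X a) ≡ 1# × (∀ b → b ≢ a → eval n c (X b) ≡ 0#)

  GC : (n : ℕ) → (Fin (dim n) → Point) → Set
  GC n X = Correct n X ×
    (∀ a → ∃ λ c → Fundamental n X a c ×
       ∃ λ (L : Fin n → Line) → ∀ p → eval n c p ≡ prodFin n (λ t → linEval (L t) p))

  Maximal : (n : ℕ) → (Fin (dim n) → Point) → Line → Set
  Maximal n X L = ∃ λ (f : Fin (suc n) → Fin (dim n)) → Injective f × (∀ t → OnLine L (X (f t)))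

  EnumeratesMaximalLines : (n : ℕ) → (X : Fin (dim n) → Point) → {m : ℕ} → (Fin m → Line) → Set
  EnumeratesMaximalLines n X {m} lam =
    (∀ t → Maximal n X (lam t)) ×
    (∀ s t → s ≢ t → ¬ SameLine (lam s) (lam t)) ×
    (∀ L → Maximal n X L → ∃ λ t → SameLine L (lam t))

  Defect : (n : ℕ) → (Fin (dim n) → Point) → ℕ → Set
  Defect n X d = ∃ λ (lam : Fin (n +ℕ 2 ∸ℕ d) → Line) → EnumeratesMaximalLines n X lam

emb-lemma : ∀ {n} → 4 ≤ n → 3 ≤ n +ℕ 2 ∸ℕ 3
emb-lemma (s≤s (s≤s (s≤s (s≤s {n = m} z≤n)))) = s≤s (m≤n+m 2 m)

-- the first three indices 1,2,3 (as Fin 3) among the n-1 maximal lines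
emb : ∀ {n} → 4 ≤ n → Fin 3 → Fin (n +ℕ 2 ∸ℕ 3)
emb h i = inject≤ i (emb-lemma h)

module Defect3 (F : RealClosedField) where
  open RealClosedField F
  open Plane F

  Distinct3 : Fin 3 → Fin 3 → Fin 3 → Set
  Distinct3 i j k = i ≢ j × j ≢ k × i ≢ k

  record Labelling (n : ℕ) (h : 4 ≤ n) (X : Fin (dim n) → Point) : Set where
    field
      -- λ_1 … λ_{n-1}: exactly the maximal lines (this is "defect 3")
      lam  : Fin (n +ℕ 2 ∸ℕ 3) → Line
      enum : EnumeratesMaximalLines n X lam
      O      : Fin 3 → Fin (dim n)
      O-inj  : Injective O
      O-zero : ∀ a t → ¬ OnLine (lam t) (X (O a))
      O-all  : ∀ b → (∀ t → ¬ OnLine (lam t) (X b)) → ∃ λ a → b ≡ O a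
      D       : Fin 3 → Fin (dim n)
      D-on    : ∀ i → OnLine (lam (emb h i)) (X (D i))
      D-oneM  : ∀ i t → t ≢ emb h i → ¬ OnLine (lam t) (X (D i))
      D-offOO : ∀ i a b → a ≢ b → ¬ Collinear (X (O a)) (X (O b)) (X (D i))
      D-all   : ∀ b t → OnLine (lam t) (X b) → (∀ t' → t' ≢ t → ¬ OnLine (lam t') (X b)) →
                (∀ a a' → a ≢ a' → ¬ Collinear (X (O a)) (X (O a')) (X b)) →
                ∃ λ i → b ≡ D i
      OO-λ : ∀ i j k → Distinct3 i j k → ∀ b →
             Collinear (X (O i)) (X (O j)) (X b) → ¬ OnLine (lam (emb h k)) (X b)
      DD : ∀ i j k → Distinct3 i j k → Collinear (X (O i)) (X (D j)) (X (D k))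

  open Labelling public

  OneMOn : ∀ {n h X} → Labelling n h X → Fin 3 → Fin (dim n) → Set
  OneMOn {n} {h} {X} S i b =
    OnLine (lam S (emb h i)) (X b) × (∀ t → t ≢ emb h i → ¬ OnLine (lam S t) (X b))

module Submission where

-- Suppose ℓᵢⱼ passed through Dₖ, and let P, Q be the two 1ₘ-nodes of λᵢ ∪ λⱼ that lie neither on
-- ℓₖᵒᵒ = OᵢOⱼ nor in {Dᵢ, Dⱼ}. Each lies on the OO-line through the O of its own maximal line and
-- Oₖ, and two nodes of one λ on such a line would put that O on λ; so P ∈ λᵢ ∩ OᵢOₖ and
-- Q ∈ λⱼ ∩ OⱼOₖ. The dual Pappus theorem for the pencils at Oₖ and at Dₖ then makes λᵢ, λⱼ and
-- OᵢOⱼ concurrent. Now factor the fundamental polynomial of P into n lines, which miss P and cover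
-- every other node. The n - 2 maximal lines other than λᵢ are among them, every factor meets λᵢ
-- in exactly one node, and the three 0ₘ-nodes need three more factors: one through Oᵢ and Oₖ would
-- contain P, one through Oⱼ and Oₖ would meet λᵢ in a node of ℓᵢᵒᵒ, and one through Oᵢ and Oⱼ
-- would meet λᵢ at λᵢ ∩ λⱼ, which already lies on the factor λⱼ. That is n + 1 factors.
--
-- Equality in the field is not decidable, so case distinctions on it are made under double
-- negation; this suffices because every statement proved is a negation.

open import Defs
open import Level using (0ℓ)
open import Algebra.Bundles using (CommutativeRing; RawRing)
open import Algebra.Solver.Ring.AlmostCommutativeRing using (fromCommutativeRing; _-Raw-AlmostCommutative⟶_)
open import Data.Nat as ℕ using (ℕ; zero; suc; _≤_; z≤n; s≤s)
open import Data.Nat.Properties using (<⇒≱; n<1+n; ≤-trans)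
import Data.Nat.Properties as ℕₚ
open import Data.Fin using (Fin; zero; suc; splitAt; join; punchIn; _≟_)
open import Data.Fin.Properties
  using (injective⇒≤; join-splitAt; all?; any?; pigeonhole; <⇒≢; punchIn-injective; punchInᵢ≢i; inject≤-injective)
open import Data.List using (List; []; _∷_)
open import Data.List.Relation.Unary.All using (All; []; _∷_)
open import Data.Maybe using (Maybe; just; nothing)
open import Data.Product using (_×_; _,_; proj₁; proj₂; ∃; ∃₂)
open import Data.Product.Properties using (≡-dec)
open import Data.Sum using (_⊎_; inj₁; inj₂)
import Data.Sum.Properties as Sum
open import Data.Empty using (⊥; ⊥-elim)
open import Function using (_∘_; flip)
open import Relation.Nullary using (¬_; yes; no; Dec)
open import Relation.Nullary.Negation using (¬¬-map)
open import Relation.Nullary.Decidable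
  using (toWitness; _×-dec_; _⊎-dec_; _→-dec_; ¬?; ¬¬-excluded-middle; decidable-stable)
open import Relation.Binary.PropositionalEquality
  using (_≡_; _≢_; refl; sym; trans; cong; cong₂; subst; subst₂; module ≡-Reasoning)
open import Relation.Binary.Structures using (IsTotalOrder)

¬¬-pull-Fin : ∀ {m} {P : Fin m → Set} → (∀ x → ¬ ¬ P x) → ¬ ¬ (∀ x → P x)
¬¬-pull-Fin {zero}  _ k = k λ ()
¬¬-pull-Fin {suc m} h k =
  h zero λ p₀ → ¬¬-pull-Fin (λ x → h (suc x)) λ ps → k λ { zero → p₀ ; (suc x) → ps x }

no-injection : ∀ {k m} → m ℕ.< k → (f : Fin k → Fin m) → (∀ {x y} → f x ≡ f y → x ≡ y) → ⊥
no-injection m<k f f-injective = <⇒≱ m<k (injective⇒≤ {f = f} f-injective)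

no-injection-⊎ : ∀ {a b m} → m ℕ.< a ℕ.+ b → (f : Fin a ⊎ Fin b → Fin m) →
                 (∀ {x y} → f x ≡ f y → x ≡ y) → ⊥
no-injection-⊎ {a} {b} m<a+b f f-injective = no-injection m<a+b (f ∘ splitAt a) λ {x} {y} e → begin
    x                        ≡⟨ join-splitAt a b x ⟨
    join a b (splitAt a x)   ≡⟨ cong (join a b) (f-injective e) ⟩
    join a b (splitAt a y)   ≡⟨ join-splitAt a b y ⟩
    y                        ∎
  where open ≡-Reasoning

injective⇒surjective : ∀ {n} (f : Fin n → Fin n) → (∀ {x y} → f x ≡ f y → x ≡ y) →
                       ∀ y → ∃ λ x → f x ≡ y
injective⇒surjective {n} f f-injective y with any? (λ x → f x ≟ y)
... | yes hit = hit
... | no miss = ⊥-elim (no-injection (n<1+n n) extended extended-injective)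
  where
  extended : Fin (suc n) → Fin n
  extended zero    = y
  extended (suc x) = f x
  extended-injective : ∀ {a b} → extended a ≡ extended b → a ≡ b
  extended-injective {zero}  {zero}  _ = refl
  extended-injective {zero}  {suc b} e = ⊥-elim (miss (b , sym e))
  extended-injective {suc a} {zero}  e = ⊥-elim (miss (a , e))
  extended-injective {suc a} {suc b} e = cong suc (f-injective e)

-- Abstract because the proof is a finite computation, which a with over a use of it would
-- otherwise unfold.
abstract
  distinct3-cover : ∀ {a b c : Fin 3} → a ≢ b × b ≢ c × a ≢ c → ∀ x → x ≡ a ⊎ x ≡ b ⊎ x ≡ c
  distinct3-cover {a} {b} {c} abc x = toWitness {a? = decision} _ a b c x abc
    where
    decision : Dec (∀ (a b c x : Fin 3) → a ≢ b × b ≢ c × a ≢ c → x ≡ a ⊎ x ≡ b ⊎ x ≡ c)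
    decision = all? λ a → all? λ b → all? λ c → all? λ x →
      (¬? (a ≟ b) ×-dec ¬? (b ≟ c) ×-dec ¬? (a ≟ c)) →-dec (x ≟ a ⊎-dec x ≟ b ⊎-dec x ≟ c)

-- A ring solver for an arbitrary commutative ring with integer coefficients. The instances in the
-- library use either natural-number coefficients (no negation) or the carrier itself, whose
-- equality is not decidable here.
module CommutativeRingSolver {c ℓ} (R : CommutativeRing c ℓ) where
  open CommutativeRing R renaming (refl to ≈-refl; sym to ≈-sym; trans to ≈-trans)
  open import Algebra.Properties.Semiring.Mult.TCOptimised semiring using (×-homo-+; ×1-homo-*)
    renaming (_×_ to _·_)
  open import Algebra.Properties.Ring ring using (-‿distribˡ-*; -‿distribʳ-*; -‿involutive; -0#≈0#)
  open import Algebra.Properties.AbelianGroup +-abelianGroup using (⁻¹-∙-comm; ⁻¹-anti-homo‿-)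
  open import Algebra.Properties.CommutativeSemigroup +-commutativeSemigroup using (interchange)
  open import Relation.Binary.Reasoning.Setoid (CommutativeRing.setoid R)

  sub-+ : ∀ x y u v → (x + y) - (u + v) ≈ (x - u) + (y - v)
  sub-+ x y u v = ≈-trans (+-congˡ (≈-sym (⁻¹-∙-comm u v))) (interchange x y (- u) (- v))

  sub-* : ∀ x y z w → (x * z + y * w) - (x * w + y * z) ≈ (x - y) * (z - w)
  sub-* x y z w = ≈-sym (begin
    (x - y) * (z - w)                           ≈⟨ distribʳ (z - w) x (- y) ⟩
    x * (z - w) + - y * (z - w)                 ≈⟨ +-cong (distribˡ x z (- w)) (distribˡ (- y) z (- w)) ⟩
    (x * z + x * - w) + (- y * z + - y * - w)   ≈⟨ +-cong (+-congˡ (≈-sym (-‿distribʳ-* x w)))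
                                                          (+-cong (≈-sym (-‿distribˡ-* y z)) -y*-w≈y*w) ⟩
    (x * z - x * w) + (- (y * z) + y * w)       ≈⟨ +-congˡ (+-comm _ _) ⟩
    (x * z - x * w) + (y * w - y * z)           ≈⟨ interchange _ _ _ _ ⟩
    (x * z + y * w) + (- (x * w) + - (y * z))   ≈⟨ +-congˡ (⁻¹-∙-comm _ _) ⟩
    (x * z + y * w) - (x * w + y * z)           ∎)
    where
    -y*-w≈y*w : - y * - w ≈ y * w
    -y*-w≈y*w = ≈-trans (≈-sym (-‿distribˡ-* y (- w)))
                  (≈-trans (-‿cong (≈-sym (-‿distribʳ-* y w))) (-‿involutive (y * w)))

  -- An integer is a pair (a , b) standing for a - b; the solver only ever sees pairs normalised
  -- to (a ∸ b , b ∸ a), for which equality is syntactic.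
  normaliseℤ : ℕ × ℕ → ℕ × ℕ
  normaliseℤ (a , b) = (a ℕ.∸ b , b ℕ.∸ a)

  integers : RawRing 0ℓ 0ℓ
  integers = record
    { Carrier = ℕ × ℕ
    ; _≈_     = _≡_
    ; _+_     = λ { (a , b) (c , d) → normaliseℤ (a ℕ.+ c , b ℕ.+ d) }
    ; _*_     = λ { (a , b) (c , d) → normaliseℤ (a ℕ.* c ℕ.+ b ℕ.* d , a ℕ.* d ℕ.+ b ℕ.* c) }
    ; -_      = λ { (a , b) → (b , a) }
    ; 0#      = (0 , 0)
    ; 1#      = (1 , 0)
    }

  -- Defined by cases so that the constants 0# and 1# are interpreted definitionally.
  ⟦_⟧ℤ : ℕ × ℕ → Carrier
  ⟦ (a , zero) ⟧ℤ  = a · 1#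
  ⟦ (a , suc b) ⟧ℤ = a · 1# - suc b · 1#

  ⟦⟧ℤ-sub : ∀ a b → ⟦ (a , b) ⟧ℤ ≈ a · 1# - b · 1#
  ⟦⟧ℤ-sub a zero    = ≈-sym (≈-trans (+-congˡ -0#≈0#) (+-identityʳ _))
  ⟦⟧ℤ-sub a (suc b) = ≈-refl

  normaliseℤ-sound : ∀ a b → ⟦ normaliseℤ (a , b) ⟧ℤ ≈ ⟦ (a , b) ⟧ℤ
  normaliseℤ-sound a b =
    ≈-trans (⟦⟧ℤ-sub (a ℕ.∸ b) (b ℕ.∸ a)) (≈-trans (cancel a b) (≈-sym (⟦⟧ℤ-sub a b)))
    where
    cancel : ∀ a b → (a ℕ.∸ b) · 1# - (b ℕ.∸ a) · 1# ≈ a · 1# - b · 1#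
    cancel zero    zero    = ≈-refl
    cancel zero    (suc b) = ≈-refl
    cancel (suc a) zero    = ≈-refl
    cancel (suc a) (suc b) = begin
      (a ℕ.∸ b) · 1# - (b ℕ.∸ a) · 1#   ≈⟨ cancel a b ⟩
      a · 1# - b · 1#                   ≈⟨ +-identityˡ _ ⟨
      0# + (a · 1# - b · 1#)            ≈⟨ +-congʳ (-‿inverseʳ 1#) ⟨
      (1# - 1#) + (a · 1# - b · 1#)     ≈⟨ sub-+ 1# (a · 1#) 1# (b · 1#) ⟨
      (1# + a · 1#) - (1# + b · 1#)     ≈⟨ +-cong (×-homo-+ 1# 1 a) (-‿cong (×-homo-+ 1# 1 b)) ⟨
      suc a · 1# - suc b · 1#           ∎

  embedding : integers -Raw-AlmostCommutative⟶ fromCommutativeRing R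
  embedding = record
    { ⟦_⟧    = ⟦_⟧ℤ
    ; +-homo = λ { (a , b) (c , d) → begin
        ⟦ normaliseℤ (a ℕ.+ c , b ℕ.+ d) ⟧ℤ      ≈⟨ normaliseℤ-sound (a ℕ.+ c) (b ℕ.+ d) ⟩
        ⟦ (a ℕ.+ c , b ℕ.+ d) ⟧ℤ                 ≈⟨ ⟦⟧ℤ-sub (a ℕ.+ c) (b ℕ.+ d) ⟩
        (a ℕ.+ c) · 1# - (b ℕ.+ d) · 1#          ≈⟨ +-cong (×-homo-+ 1# a c) (-‿cong (×-homo-+ 1# b d)) ⟩
        (a · 1# + c · 1#) - (b · 1# + d · 1#)    ≈⟨ sub-+ _ _ _ _ ⟩
        (a · 1# - b · 1#) + (c · 1# - d · 1#)    ≈⟨ +-cong (⟦⟧ℤ-sub a b) (⟦⟧ℤ-sub c d) ⟨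
        ⟦ (a , b) ⟧ℤ + ⟦ (c , d) ⟧ℤ              ∎ }
    ; *-homo = λ { (a , b) (c , d) → begin
        ⟦ normaliseℤ (a ℕ.* c ℕ.+ b ℕ.* d , a ℕ.* d ℕ.+ b ℕ.* c) ⟧ℤ
          ≈⟨ normaliseℤ-sound (a ℕ.* c ℕ.+ b ℕ.* d) (a ℕ.* d ℕ.+ b ℕ.* c) ⟩
        ⟦ (a ℕ.* c ℕ.+ b ℕ.* d , a ℕ.* d ℕ.+ b ℕ.* c) ⟧ℤ
          ≈⟨ ⟦⟧ℤ-sub (a ℕ.* c ℕ.+ b ℕ.* d) (a ℕ.* d ℕ.+ b ℕ.* c) ⟩
        (a ℕ.* c ℕ.+ b ℕ.* d) · 1# - (a ℕ.* d ℕ.+ b ℕ.* c) · 1#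
          ≈⟨ +-cong (≈-trans (×-homo-+ 1# (a ℕ.* c) (b ℕ.* d)) (+-cong (×1-homo-* a c) (×1-homo-* b d)))
                    (-‿cong (≈-trans (×-homo-+ 1# (a ℕ.* d) (b ℕ.* c)) (+-cong (×1-homo-* a d) (×1-homo-* b c)))) ⟩
        (a · 1# * c · 1# + b · 1# * d · 1#) - (a · 1# * d · 1# + b · 1# * c · 1#)
          ≈⟨ sub-* _ _ _ _ ⟩
        (a · 1# - b · 1#) * (c · 1# - d · 1#)
          ≈⟨ *-cong (⟦⟧ℤ-sub a b) (⟦⟧ℤ-sub c d) ⟨
        ⟦ (a , b) ⟧ℤ * ⟦ (c , d) ⟧ℤ
          ∎ }
    ; -‿homo = λ { (a , b) → begin
        ⟦ (b , a) ⟧ℤ            ≈⟨ ⟦⟧ℤ-sub b a ⟩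
        b · 1# - a · 1#         ≈⟨ ⁻¹-anti-homo‿- _ _ ⟨
        - (a · 1# - b · 1#)     ≈⟨ -‿cong (⟦⟧ℤ-sub a b) ⟨
        - ⟦ (a , b) ⟧ℤ          ∎ }
    ; 0-homo = ≈-refl
    ; 1-homo = ≈-refl
    }

  _≟ℤ_ : ∀ m n → Maybe (⟦ m ⟧ℤ ≈ ⟦ n ⟧ℤ)
  m ≟ℤ n with ≡-dec ℕₚ._≟_ ℕₚ._≟_ m n
  ... | yes refl = just ≈-refl
  ... | no _     = nothing

  open import Algebra.Solver.Ring integers (fromCommutativeRing R) embedding _≟ℤ_ public
    using (solve; _:=_; con; _:+_; _:*_; _:-_; :-_)

-- Stated over arbitrary operations so that the same formulas serve both in the field and, as
-- syntax, in the solver.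
module Coordinates {A : Set} (add mul sub : A → A → A) (0# : A) where
  private
    infixl 6 _+_ _-_
    infixl 7 _*_
    _+_ _*_ _-_ : A → A → A
    _+_ = add
    _*_ = mul
    _-_ = sub

  det : A × A → A × A → A × A → A
  det (p₁ , p₂) (q₁ , q₂) (r₁ , r₂) = (q₁ - p₁) * (r₂ - p₂) - (q₂ - p₂) * (r₁ - p₁)

  -- The affine map sending o, a, b to (0, 0), (Δ, 0), (0, Δ), where Δ = det o a b.
  frameCoordinates : A × A → A × A → A × A → A × A → A × A
  frameCoordinates o a b x = (det o x b , det o a x)

  combination : List (A × A) → A
  combination []              = 0#
  combination ((m , h) ∷ mhs) = m * h + combination mhs

module FieldProperties (F : RealClosedField) where
  open RealClosedField F public
  commutativeRing : CommutativeRing 0ℓ 0ℓ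
  commutativeRing = record { isCommutativeRing = isCommutativeRing }
  open CommutativeRing commutativeRing public
    using (_-_; +-comm; *-comm; *-assoc; +-identityˡ; +-identityʳ; *-identityˡ; zeroˡ; zeroʳ; -‿inverseʳ; +-group)
  open CommutativeRingSolver commutativeRing public
  open import Algebra.Properties.Group +-group public using (x∙y⁻¹≈ε⇒x≈y; x≈y⇒x∙y⁻¹≈ε)
  open IsTotalOrder isTotalOrder using (total; antisym)
  open ≡-Reasoning

  *-cancel-≢0 : ∀ {x y} → x ≢ 0# → x * y ≡ 0# → y ≡ 0#
  *-cancel-≢0 {x} {y} x≢0 xy≡0 with inverse x x≢0
  ... | x⁻¹ , xx⁻¹≡1 = begin
    y               ≡⟨ *-identityˡ y ⟨
    1# * y          ≡⟨ cong (_* y) (trans (sym xx⁻¹≡1) (*-comm x x⁻¹)) ⟩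
    (x⁻¹ * x) * y   ≡⟨ *-assoc x⁻¹ x y ⟩
    x⁻¹ * (x * y)   ≡⟨ cong (x⁻¹ *_) xy≡0 ⟩
    x⁻¹ * 0#        ≡⟨ zeroʳ x⁻¹ ⟩
    0#              ∎

  zero-product : ∀ {x y} → x * y ≡ 0# → ¬ ¬ (x ≡ 0# ⊎ y ≡ 0#)
  zero-product xy≡0 k = ¬¬-excluded-middle λ
    { (yes x≡0) → k (inj₁ x≡0)
    ; (no x≢0)  → k (inj₂ (*-cancel-≢0 x≢0 xy≡0))
    }

  *-≢0 : ∀ {x y} → x ≢ 0# → y ≢ 0# → x * y ≢ 0#
  *-≢0 x≢0 y≢0 xy≡0 = y≢0 (*-cancel-≢0 x≢0 xy≡0)

  square-nonneg : ∀ x → 0# ≤F (x * x)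
  square-nonneg x with total 0# x
  ... | inj₁ 0≤x = *-nonneg x x 0≤x 0≤x
  ... | inj₂ x≤0 = subst (0# ≤F_) (-x*-x≡x*x x) (*-nonneg (- x) (- x) 0≤-x 0≤-x)
    where
    0≤-x : 0# ≤F (- x)
    0≤-x = subst₂ _≤F_ (-‿inverseʳ x) (+-identityˡ (- x)) (+-mono-≤ x 0# (- x) x≤0)
    -x*-x≡x*x : ∀ x → - x * - x ≡ x * x
    -x*-x≡x*x = solve 1 (λ x → :- x :* :- x := x :* x) refl

  nonneg-sum-≡0 : ∀ {x y} → 0# ≤F x → 0# ≤F y → x + y ≡ 0# → x ≡ 0#
  nonneg-sum-≡0 {x} {y} 0≤x 0≤y x+y≡0 =
    antisym (subst₂ _≤F_ (+-identityˡ x) (trans (+-comm y x) x+y≡0) (+-mono-≤ 0# y x 0≤y)) 0≤x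

  sum-of-squares-≢0 : ∀ {a b} → ¬ (a ≡ 0# × b ≡ 0#) → a * a + b * b ≢ 0#
  sum-of-squares-≢0 {a} {b} ¬a≡0×b≡0 a²+b²≡0 =
    square-≡0 a²≡0 λ a≡0 → square-≡0 b²≡0 λ b≡0 → ¬a≡0×b≡0 (a≡0 , b≡0)
    where
    square-≡0 : ∀ {x} → x * x ≡ 0# → ¬ ¬ (x ≡ 0#)
    square-≡0 x²≡0 x≢0 = x≢0 (*-cancel-≢0 x≢0 x²≡0)
    a²≡0 : a * a ≡ 0#
    a²≡0 = nonneg-sum-≡0 (square-nonneg a) (square-nonneg b) a²+b²≡0
    b²≡0 : b * b ≡ 0#
    b²≡0 = nonneg-sum-≡0 (square-nonneg b) (square-nonneg a) (trans (+-comm _ _) a²+b²≡0)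

  open Coordinates _+_ _*_ _-_ 0# public

  combination-≡0 : ∀ {mhs} → All (λ mh → proj₂ mh ≡ 0#) mhs → combination mhs ≡ 0#
  combination-≡0 []                            = refl
  combination-≡0 {(m , _) ∷ mhs} (refl ∷ hs) = begin
    m * 0# + combination mhs   ≡⟨ cong₂ _+_ (zeroʳ m) (combination-≡0 hs) ⟩
    0# + 0#                    ≡⟨ +-identityʳ 0# ⟩
    0#                         ∎

  module Poly {k} = Coordinates (_:+_ {k}) _:*_ _:-_ (con (0 , 0))

module PlaneGeometry (F : RealClosedField) where
  open FieldProperties F
  open Plane F using (Point; Line; line; OnLine; SameLine; Collinear)
  open ≡-Reasoning

  det-on-line-certificate : ∀ a b c p₁ p₂ q₁ q₂ r₁ r₂ →
    (a * a + b * b) * det (p₁ , p₂) (q₁ , q₂) (r₁ , r₂) ≡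
    combination ( (a * (q₂ - r₂) + b * (r₁ - q₁) , a * p₁ + b * p₂ + c)
                ∷ (a * (r₂ - p₂) + b * (p₁ - r₁) , a * q₁ + b * q₂ + c)
                ∷ (a * (p₂ - q₂) + b * (q₁ - p₁) , a * r₁ + b * r₂ + c) ∷ [])
  det-on-line-certificate = solve 9 (λ a b c p₁ p₂ q₁ q₂ r₁ r₂ →
    (a :* a :+ b :* b) :* Poly.det (p₁ , p₂) (q₁ , q₂) (r₁ , r₂) :=
    Poly.combination ( (a :* (q₂ :- r₂) :+ b :* (r₁ :- q₁) , a :* p₁ :+ b :* p₂ :+ c)
                     ∷ (a :* (r₂ :- p₂) :+ b :* (p₁ :- r₁) , a :* q₁ :+ b :* q₂ :+ c)
                     ∷ (a :* (p₂ :- q₂) :+ b :* (q₁ :- p₁) , a :* r₁ :+ b :* r₂ :+ c) ∷ [])) refl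

  det-≡0-on-line : ∀ (L : Line) {p q r} → OnLine L p → OnLine L q → OnLine L r → det p q r ≡ 0#
  det-≡0-on-line (line a b c nondeg) {p₁ , p₂} {q₁ , q₂} {r₁ , r₂} p∈L q∈L r∈L =
    *-cancel-≢0 (sum-of-squares-≢0 nondeg)
      (trans (det-on-line-certificate a b c p₁ p₂ q₁ q₂ r₁ r₂) (combination-≡0 (p∈L ∷ q∈L ∷ r∈L ∷ [])))

  collinear⇒det≡0 : ∀ {p q r} → Collinear p q r → det p q r ≡ 0#
  collinear⇒det≡0 (L , p∈L , q∈L , r∈L) = det-≡0-on-line L p∈L q∈L r∈L

  collinear-swap₁₂ : ∀ {p q r} → Collinear p q r → Collinear q p r
  collinear-swap₁₂ (L , p∈L , q∈L , r∈L) = L , q∈L , p∈L , r∈L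

  collinear-rotate : ∀ {p q r} → Collinear p q r → Collinear q r p
  collinear-rotate (L , p∈L , q∈L , r∈L) = L , q∈L , r∈L , p∈L

  on-line-certificate : ∀ a b c p₁ p₂ q₁ q₂ r₁ r₂ →
    ((q₁ - p₁) * (q₁ - p₁) + (q₂ - p₂) * (q₂ - p₂)) * (a * r₁ + b * r₂ + c) ≡
    combination ( ((q₁ - p₁) * (q₁ - r₁) + (q₂ - p₂) * (q₂ - r₂) , a * p₁ + b * p₂ + c)
                ∷ ((q₁ - p₁) * (r₁ - p₁) + (q₂ - p₂) * (r₂ - p₂) , a * q₁ + b * q₂ + c)
                ∷ (b * (q₁ - p₁) - a * (q₂ - p₂) , det (p₁ , p₂) (q₁ , q₂) (r₁ , r₂)) ∷ [])
  on-line-certificate = solve 9 (λ a b c p₁ p₂ q₁ q₂ r₁ r₂ →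
    ((q₁ :- p₁) :* (q₁ :- p₁) :+ (q₂ :- p₂) :* (q₂ :- p₂)) :* (a :* r₁ :+ b :* r₂ :+ c) :=
    Poly.combination ( ((q₁ :- p₁) :* (q₁ :- r₁) :+ (q₂ :- p₂) :* (q₂ :- r₂) , a :* p₁ :+ b :* p₂ :+ c)
                     ∷ ((q₁ :- p₁) :* (r₁ :- p₁) :+ (q₂ :- p₂) :* (r₂ :- p₂) , a :* q₁ :+ b :* q₂ :+ c)
                     ∷ (b :* (q₁ :- p₁) :- a :* (q₂ :- p₂) , Poly.det (p₁ , p₂) (q₁ , q₂) (r₁ , r₂))
                     ∷ [])) refl

  on-line-by-det : ∀ (L : Line) {p q r} → OnLine L p → OnLine L q → p ≢ q → det p q r ≡ 0# → OnLine L r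
  on-line-by-det (line a b c _) {p₁ , p₂} {q₁ , q₂} {r₁ , r₂} p∈L q∈L p≢q det≡0 =
    *-cancel-≢0 (sum-of-squares-≢0 q-p≢0)
      (trans (on-line-certificate a b c p₁ p₂ q₁ q₂ r₁ r₂) (combination-≡0 (p∈L ∷ q∈L ∷ det≡0 ∷ [])))
    where
    q-p≢0 : ¬ (q₁ - p₁ ≡ 0# × q₂ - p₂ ≡ 0#)
    q-p≢0 (e₁ , e₂) = p≢q (sym (cong₂ _,_ (x∙y⁻¹≈ε⇒x≈y _ _ e₁) (x∙y⁻¹≈ε⇒x≈y _ _ e₂)))

  on-line-through-common-points : ∀ (L M : Line) {p q r} → p ≢ q → OnLine L p → OnLine L q →
                                  OnLine M p → OnLine M q → OnLine M r → OnLine L r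
  on-line-through-common-points L M p≢q p∈L q∈L p∈M q∈M r∈M =
    on-line-by-det L p∈L q∈L p≢q (det-≡0-on-line M p∈M q∈M r∈M)

  same-line-through-common-points : ∀ (L M : Line) {p q} → p ≢ q → OnLine L p → OnLine L q →
                                    OnLine M p → OnLine M q → SameLine L M
  same-line-through-common-points L M p≢q p∈L q∈L p∈M q∈M r =
    on-line-through-common-points M L p≢q p∈M q∈M p∈L q∈L ,
    on-line-through-common-points L M p≢q p∈L q∈L p∈M q∈M

  det-frameCoordinates : ∀ o a b x y z → let T = frameCoordinates o a b in
    det (T x) (T y) (T z) ≡ det o a b * det x y z
  det-frameCoordinates (o₁ , o₂) (a₁ , a₂) (b₁ , b₂) (x₁ , x₂) (y₁ , y₂) (z₁ , z₂) =
    solve 12 (λ o₁ o₂ a₁ a₂ b₁ b₂ x₁ x₂ y₁ y₂ z₁ z₂ →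
      let T = Poly.frameCoordinates (o₁ , o₂) (a₁ , a₂) (b₁ , b₂) in
      Poly.det (T (x₁ , x₂)) (T (y₁ , y₂)) (T (z₁ , z₂)) :=
      Poly.det (o₁ , o₂) (a₁ , a₂) (b₁ , b₂) :* Poly.det (x₁ , x₂) (y₁ , y₂) (z₁ , z₂))
      refl o₁ o₂ a₁ a₂ b₁ b₂ x₁ x₂ y₁ y₂ z₁ z₂

  det-repeat₁₂ : ∀ p q → det p p q ≡ 0#
  det-repeat₁₂ (p₁ , p₂) (q₁ , q₂) =
    solve 4 (λ p₁ p₂ q₁ q₂ → Poly.det (p₁ , p₂) (p₁ , p₂) (q₁ , q₂) := con (0 , 0)) refl p₁ p₂ q₁ q₂

  det-repeat₁₃ : ∀ p q → det p q p ≡ 0#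
  det-repeat₁₃ (p₁ , p₂) (q₁ , q₂) =
    solve 4 (λ p₁ p₂ q₁ q₂ → Poly.det (p₁ , p₂) (q₁ , q₂) (p₁ , p₂) := con (0 , 0)) refl p₁ p₂ q₁ q₂

  det-repeat₂₃ : ∀ p q → det p q q ≡ 0#
  det-repeat₂₃ (p₁ , p₂) (q₁ , q₂) =
    solve 4 (λ p₁ p₂ q₁ q₂ → Poly.det (p₁ , p₂) (q₁ , q₂) (q₁ , q₂) := con (0 , 0)) refl p₁ p₂ q₁ q₂

  frameCoordinates-frame : ∀ o a b → let T = frameCoordinates o a b; Δ = det o a b in
    T o ≡ (0# , 0#) × T a ≡ (Δ , 0#) × T b ≡ (0# , Δ)
  frameCoordinates-frame o a b =
    cong₂ _,_ (det-repeat₁₂ o b) (det-repeat₁₃ o a) ,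
    cong (det o a b ,_) (det-repeat₂₃ o a) ,
    cong (_, det o a b) (det-repeat₂₃ o b)

  frameCoordinates-inverse₁ : ∀ o₁ o₂ a₁ a₂ b₁ b₂ x₁ x₂ y₁ y₂ →
    let o = (o₁ , o₂); a = (a₁ , a₂); b = (b₁ , b₂); x = (x₁ , x₂); y = (y₁ , y₂) in
    det o a b * (x₁ - y₁) ≡
    combination ((a₁ - o₁ , det o x b - det o y b) ∷ (b₁ - o₁ , det o a x - det o a y) ∷ [])
  frameCoordinates-inverse₁ = solve 10 (λ o₁ o₂ a₁ a₂ b₁ b₂ x₁ x₂ y₁ y₂ →
    let o = (o₁ , o₂); a = (a₁ , a₂); b = (b₁ , b₂); x = (x₁ , x₂); y = (y₁ , y₂) in
    Poly.det o a b :* (x₁ :- y₁) :=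
    Poly.combination ( (a₁ :- o₁ , Poly.det o x b :- Poly.det o y b)
                     ∷ (b₁ :- o₁ , Poly.det o a x :- Poly.det o a y) ∷ []))
    refl

  frameCoordinates-inverse₂ : ∀ o₁ o₂ a₁ a₂ b₁ b₂ x₁ x₂ y₁ y₂ →
    let o = (o₁ , o₂); a = (a₁ , a₂); b = (b₁ , b₂); x = (x₁ , x₂); y = (y₁ , y₂) in
    det o a b * (x₂ - y₂) ≡
    combination ((a₂ - o₂ , det o x b - det o y b) ∷ (b₂ - o₂ , det o a x - det o a y) ∷ [])
  frameCoordinates-inverse₂ = solve 10 (λ o₁ o₂ a₁ a₂ b₁ b₂ x₁ x₂ y₁ y₂ →
    let o = (o₁ , o₂); a = (a₁ , a₂); b = (b₁ , b₂); x = (x₁ , x₂); y = (y₁ , y₂) in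
    Poly.det o a b :* (x₂ :- y₂) :=
    Poly.combination ( (a₂ :- o₂ , Poly.det o x b :- Poly.det o y b)
                     ∷ (b₂ :- o₂ , Poly.det o a x :- Poly.det o a y) ∷ []))
    refl

  frameCoordinates-injective : ∀ o a b {x y} → det o a b ≢ 0# →
                               frameCoordinates o a b x ≡ frameCoordinates o a b y → x ≡ y
  frameCoordinates-injective o@(o₁ , o₂) a@(a₁ , a₂) b@(b₁ , b₂) {x@(x₁ , x₂)} {y@(y₁ , y₂)} Δ≢0 Tx≡Ty =
    cong₂ _,_ (coordinate (frameCoordinates-inverse₁ o₁ o₂ a₁ a₂ b₁ b₂ x₁ x₂ y₁ y₂))
              (coordinate (frameCoordinates-inverse₂ o₁ o₂ a₁ a₂ b₁ b₂ x₁ x₂ y₁ y₂))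
    where
    coordinate : ∀ {u v m₁ m₂} →
      det o a b * (u - v) ≡ combination ((m₁ , det o x b - det o y b) ∷ (m₂ , det o a x - det o a y) ∷ []) → u ≡ v
    coordinate certificate = x∙y⁻¹≈ε⇒x≈y _ _ (*-cancel-≢0 Δ≢0 (trans certificate (combination-≡0
      (x≈y⇒x∙y⁻¹≈ε (cong proj₁ Tx≡Ty) ∷ x≈y⇒x∙y⁻¹≈ε (cong proj₂ Tx≡Ty) ∷ []))))

  record DualPappusConfiguration (Oₖ Oᵢ Oⱼ Dᵢ Dⱼ Dₖ P Q r : Point) : Set where
    field
      P∈OₖOᵢ  : det Oₖ Oᵢ P ≡ 0#
      Q∈OₖOⱼ  : det Oₖ Q Oⱼ ≡ 0#
      Oₖ∈DᵢDⱼ : det Oₖ Dᵢ Dⱼ ≡ 0#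
      Oᵢ∈DⱼDₖ : det Oᵢ Dⱼ Dₖ ≡ 0#
      Oⱼ∈DᵢDₖ : det Oⱼ Dᵢ Dₖ ≡ 0#
      Dₖ∈PQ   : det P Q Dₖ ≡ 0#
      r∈PDᵢ   : det P Dᵢ r ≡ 0#
      r∈OᵢOⱼ  : det Oᵢ Oⱼ r ≡ 0#

  open DualPappusConfiguration public

  frameCoordinates-configuration : ∀ {Oₖ Oᵢ Oⱼ Dᵢ Dⱼ Dₖ P Q r} →
    DualPappusConfiguration Oₖ Oᵢ Oⱼ Dᵢ Dⱼ Dₖ P Q r →
    let T = frameCoordinates Oₖ Oᵢ Oⱼ in
    DualPappusConfiguration (T Oₖ) (T Oᵢ) (T Oⱼ) (T Dᵢ) (T Dⱼ) (T Dₖ) (T P) (T Q) (T r)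
  frameCoordinates-configuration {Oₖ} {Oᵢ} {Oⱼ} c = record
    { P∈OₖOᵢ  = preserve (P∈OₖOᵢ c)
    ; Q∈OₖOⱼ  = preserve (Q∈OₖOⱼ c)
    ; Oₖ∈DᵢDⱼ = preserve (Oₖ∈DᵢDⱼ c)
    ; Oᵢ∈DⱼDₖ = preserve (Oᵢ∈DⱼDₖ c)
    ; Oⱼ∈DᵢDₖ = preserve (Oⱼ∈DᵢDₖ c)
    ; Dₖ∈PQ   = preserve (Dₖ∈PQ c)
    ; r∈PDᵢ   = preserve (r∈PDᵢ c)
    ; r∈OᵢOⱼ  = preserve (r∈OᵢOⱼ c)
    }
    where
    T = frameCoordinates Oₖ Oᵢ Oⱼ
    preserve : ∀ {x y z} → det x y z ≡ 0# → det (T x) (T y) (T z) ≡ 0#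
    preserve {x} {y} {z} det≡0 = begin
      det (T x) (T y) (T z)         ≡⟨ det-frameCoordinates Oₖ Oᵢ Oⱼ x y z ⟩
      det Oₖ Oᵢ Oⱼ * det x y z      ≡⟨ cong (det Oₖ Oᵢ Oⱼ *_) det≡0 ⟩
      det Oₖ Oᵢ Oⱼ * 0#             ≡⟨ zeroʳ _ ⟩
      0#                            ∎

  -- The factor a₁ + a₂ - p is where the degenerate cases P = Dᵢ and P = Oᵢ enter.
  pappus-certificate : ∀ Δ p q a₁ a₂ b₁ b₂ c₁ c₂ r₁ →
    let Oₖ = (0# , 0#); Oᵢ = (Δ , 0#); Oⱼ = (0# , Δ); P = (p , 0#); Q = (0# , q)
        Dᵢ = (a₁ , a₂); Dⱼ = (b₁ , b₂); Dₖ = (c₁ , c₂); r = (r₁ , Δ - r₁) in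
    Δ * (a₁ + a₂ - p) * det Q Dⱼ r ≡ combination
      ( (Δ * p + Δ * q - Δ * Δ - q * c₁ - p * c₂ , det Oₖ Dᵢ Dⱼ)
      ∷ (Δ * p - q * a₁ - p * a₂                 , det Oᵢ Dⱼ Dₖ)
      ∷ (p * b₂ + q * b₁ - Δ * q                 , det Oⱼ Dᵢ Dₖ)
      ∷ (Δ * (b₁ + a₂ - Δ)                       , det P Q Dₖ)
      ∷ (Δ * (b₁ + b₂ - q)                       , det P Dᵢ r) ∷ [])
  pappus-certificate = solve 10 (λ Δ p q a₁ a₂ b₁ b₂ c₁ c₂ r₁ →
    let O = con (0 , 0); Oₖ = (O , O); Oᵢ = (Δ , O); Oⱼ = (O , Δ); P = (p , O); Q = (O , q)
        Dᵢ = (a₁ , a₂); Dⱼ = (b₁ , b₂); Dₖ = (c₁ , c₂); r = (r₁ , Δ :- r₁) in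
    Δ :* (a₁ :+ a₂ :- p) :* Poly.det Q Dⱼ r := Poly.combination
      ( (Δ :* p :+ Δ :* q :- Δ :* Δ :- q :* c₁ :- p :* c₂ , Poly.det Oₖ Dᵢ Dⱼ)
      ∷ (Δ :* p :- q :* a₁ :- p :* a₂                     , Poly.det Oᵢ Dⱼ Dₖ)
      ∷ (p :* b₂ :+ q :* b₁ :- Δ :* q                     , Poly.det Oⱼ Dᵢ Dₖ)
      ∷ (Δ :* (b₁ :+ a₂ :- Δ)                             , Poly.det P Q Dₖ)
      ∷ (Δ :* (b₁ :+ b₂ :- q)                             , Poly.det P Dᵢ r) ∷ [])) refl

  det-axis₁ : ∀ Δ x y → det (0# , 0#) (Δ , 0#) (x , y) ≡ Δ * y
  det-axis₁ = solve 3 (λ Δ x y → Poly.det (con (0 , 0) , con (0 , 0)) (Δ , con (0 , 0)) (x , y) := Δ :* y) refl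

  det-axis₂ : ∀ Δ x y → det (0# , 0#) (x , y) (0# , Δ) ≡ Δ * x
  det-axis₂ = solve 3 (λ Δ x y → Poly.det (con (0 , 0) , con (0 , 0)) (x , y) (con (0 , 0) , Δ) := Δ :* x) refl

  det-diagonal : ∀ Δ x y → det (Δ , 0#) (0# , Δ) (x , y) ≡ Δ * (Δ - x - y)
  det-diagonal = solve 3 (λ Δ x y → Poly.det (Δ , con (0 , 0)) (con (0 , 0) , Δ) (x , y) := Δ :* (Δ :- x :- y)) refl

  degenerate-certificate : ∀ Δ p a₁ a₂ r₁ →
    a₂ * (Δ - p) ≡ combination ((Δ - r₁ , a₁ + a₂ - p) ∷ (- 1# , det (p , 0#) (a₁ , a₂) (r₁ , Δ - r₁)) ∷ [])
  degenerate-certificate = solve 5 (λ Δ p a₁ a₂ r₁ →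
    a₂ :* (Δ :- p) :=
    Poly.combination ( (Δ :- r₁ , a₁ :+ a₂ :- p)
                     ∷ (:- con (1 , 0) , Poly.det (p , con (0 , 0)) (a₁ , a₂) (r₁ , Δ :- r₁)) ∷ [])) refl

  first-coordinate-certificate : ∀ p a₁ a₂ →
    a₁ - p ≡ combination ((1# , a₁ + a₂ - p) ∷ (- 1# , a₂) ∷ [])
  first-coordinate-certificate = solve 3 (λ p a₁ a₂ →
    a₁ :- p := Poly.combination ((con (1 , 0) , a₁ :+ a₂ :- p) ∷ (:- con (1 , 0) , a₂) ∷ [])) refl

  dual-pappus-on-axes : ∀ {Δ a₁ a₂ b₁ b₂ c₁ c₂ p p₂ q₁ q r₁ r₂} →
    Δ ≢ 0# → p₂ ≡ 0# → q₁ ≡ 0# → Δ - r₁ ≡ r₂ →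
    DualPappusConfiguration (0# , 0#) (Δ , 0#) (0# , Δ) (a₁ , a₂) (b₁ , b₂) (c₁ , c₂)
                            (p , p₂) (q₁ , q) (r₁ , r₂) →
    (p , p₂) ≢ (a₁ , a₂) → (p , p₂) ≢ (Δ , 0#) → ¬ ¬ (det (q₁ , q) (b₁ , b₂) (r₁ , r₂) ≡ 0#)
  dual-pappus-on-axes {Δ} {a₁} {a₂} {b₁} {b₂} {c₁} {c₂} {p} {q = q} {r₁}
                      Δ≢0 refl refl refl c P≢Dᵢ P≢Oᵢ g≢0 =
    zero-product s*g≡0 λ
      { (inj₂ g≡0) → g≢0 g≡0
      ; (inj₁ s≡0) → zero-product (a₂[Δ-p]≡0 s≡0) λ
          { (inj₁ a₂≡0) → P≢Dᵢ (cong₂ _,_ (sym (a₁≡p s≡0 a₂≡0)) (sym a₂≡0))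
          ; (inj₂ Δ-p≡0) → P≢Oᵢ (cong (_, 0#) (sym (x∙y⁻¹≈ε⇒x≈y _ _ Δ-p≡0))) } }
    where
    s = a₁ + a₂ - p
    s*g≡0 : s * det (0# , q) (b₁ , b₂) (r₁ , Δ - r₁) ≡ 0#
    s*g≡0 = *-cancel-≢0 Δ≢0 (trans (sym (*-assoc Δ s _))
      (trans (pappus-certificate Δ p q a₁ a₂ b₁ b₂ c₁ c₂ r₁)
             (combination-≡0 (Oₖ∈DᵢDⱼ c ∷ Oᵢ∈DⱼDₖ c ∷ Oⱼ∈DᵢDₖ c ∷ Dₖ∈PQ c ∷ r∈PDᵢ c ∷ []))))
    a₂[Δ-p]≡0 : s ≡ 0# → a₂ * (Δ - p) ≡ 0#
    a₂[Δ-p]≡0 s≡0 = trans (degenerate-certificate Δ p a₁ a₂ r₁) (combination-≡0 (s≡0 ∷ r∈PDᵢ c ∷ []))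
    a₁≡p : s ≡ 0# → a₂ ≡ 0# → a₁ ≡ p
    a₁≡p s≡0 a₂≡0 =
      x∙y⁻¹≈ε⇒x≈y _ _ (trans (first-coordinate-certificate p a₁ a₂) (combination-≡0 (s≡0 ∷ a₂≡0 ∷ [])))

  dual-pappus-normalised : ∀ {Δ Oₖ Oᵢ Oⱼ Dᵢ Dⱼ Dₖ P Q r} →
    Oₖ ≡ (0# , 0#) → Oᵢ ≡ (Δ , 0#) → Oⱼ ≡ (0# , Δ) → Δ ≢ 0# →
    DualPappusConfiguration Oₖ Oᵢ Oⱼ Dᵢ Dⱼ Dₖ P Q r → P ≢ Dᵢ → P ≢ Oᵢ → ¬ ¬ (det Q Dⱼ r ≡ 0#)
  dual-pappus-normalised {Δ} {Dᵢ = _ , _} {_ , _} {_ , _} {p , p₂} {q₁ , q} {r₁ , r₂} refl refl refl Δ≢0 c =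
    dual-pappus-on-axes Δ≢0
      (*-cancel-≢0 Δ≢0 (trans (sym (det-axis₁ Δ p p₂)) (P∈OₖOᵢ c)))
      (*-cancel-≢0 Δ≢0 (trans (sym (det-axis₂ Δ q₁ q)) (Q∈OₖOⱼ c)))
      (x∙y⁻¹≈ε⇒x≈y _ _ (*-cancel-≢0 Δ≢0 (trans (sym (det-diagonal Δ r₁ r₂)) (r∈OᵢOⱼ c))))
      c

  -- The dual of Pappus's theorem for the pencils through Oₖ (the lines OₖOᵢP, OₖOⱼQ, OₖDᵢDⱼ) and
  -- through Dₖ (the lines DₖOᵢDⱼ, DₖOⱼDᵢ, DₖPQ): the diagonals PDᵢ, QDⱼ and OᵢOⱼ are concurrent.
  dual-pappus : ∀ {Oₖ Oᵢ Oⱼ Dᵢ Dⱼ Dₖ P Q r} → det Oₖ Oᵢ Oⱼ ≢ 0# →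
    DualPappusConfiguration Oₖ Oᵢ Oⱼ Dᵢ Dⱼ Dₖ P Q r → P ≢ Dᵢ → P ≢ Oᵢ → ¬ ¬ (det Q Dⱼ r ≡ 0#)
  dual-pappus {Oₖ} {Oᵢ} {Oⱼ} {Dᵢ} {Dⱼ} {Dₖ} {P} {Q} {r} Δ≢0 c P≢Dᵢ P≢Oᵢ =
    ¬¬-map (λ e → *-cancel-≢0 Δ≢0 (trans (sym (det-frameCoordinates Oₖ Oᵢ Oⱼ Q Dⱼ r)) e))
      (dual-pappus-normalised Tₖ Tᵢ Tⱼ Δ≢0 (frameCoordinates-configuration c)
        (P≢Dᵢ ∘ frameCoordinates-injective Oₖ Oᵢ Oⱼ Δ≢0)
        (P≢Oᵢ ∘ frameCoordinates-injective Oₖ Oᵢ Oⱼ Δ≢0))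
    where
    Tₖ = proj₁ (frameCoordinates-frame Oₖ Oᵢ Oⱼ)
    Tᵢ = proj₁ (proj₂ (frameCoordinates-frame Oₖ Oᵢ Oⱼ))
    Tⱼ = proj₂ (proj₂ (frameCoordinates-frame Oₖ Oᵢ Oⱼ))

module Factorisation (F : RealClosedField) where
  open FieldProperties F
  open PlaneGeometry F
  open Plane F using (Point; Line; OnLine; SameLine; prodFin; dim; GC; Maximal; Injective)

  prodFin-≡0 : ∀ m (f : Fin m → Carrier) t → f t ≡ 0# → prodFin m f ≡ 0#
  prodFin-≡0 (suc m) f zero    e = trans (cong (_* prodFin m (f ∘ suc)) e) (zeroˡ _)
  prodFin-≡0 (suc m) f (suc t) e = trans (cong (f zero *_) (prodFin-≡0 m (f ∘ suc) t e)) (zeroʳ _)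

  prodFin-≢0 : ∀ m (f : Fin m → Carrier) → (∀ t → f t ≢ 0#) → prodFin m f ≢ 0#
  prodFin-≢0 zero    f _   1≡0 = 0≢1 (sym 1≡0)
  prodFin-≢0 (suc m) f f≢0 = *-≢0 (f≢0 zero) (prodFin-≢0 m (f ∘ suc) (f≢0 ∘ suc))

  record FundamentalLines (n : ℕ) (X : Fin (dim n) → Point) (A : Fin (dim n)) : Set where
    field
      factor : Fin n → Line
      avoids : ∀ t → ¬ OnLine (factor t) (X A)
      covers : ∀ b → b ≢ A → ¬ ¬ (∃ λ t → OnLine (factor t) (X b))

  fundamentalLines : ∀ {n X} → GC n X → ∀ A → FundamentalLines n X A
  fundamentalLines {n} {X} (_ , factorises) A with factorises A
  ... | c , (c[A]≡1 , c[b]≡0) , L , c≡ΠL = record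
    { factor = L
    ; avoids = λ t A∈L → 0≢1 (sym (trans (sym c[A]≡1) (trans (c≡ΠL (X A)) (prodFin-≡0 n _ t A∈L))))
    ; covers = λ b b≢A b∉L →
        prodFin-≢0 n _ (λ t b∈L → b∉L (t , b∈L)) (trans (sym (c≡ΠL (X b))) (c[b]≡0 b b≢A))
    }

  module Covering {n X} (X-injective : Injective X) {A} (C : FundamentalLines n X A) where
    open FundamentalLines C public

    factor-meets-line-through-A-once : ∀ M t {x y} → OnLine M (X A) → x ≢ y →
      OnLine (factor t) x → OnLine (factor t) y → OnLine M x → OnLine M y → ⊥
    factor-meets-line-through-A-once M t A∈M x≢y x∈L y∈L x∈M y∈M =
      avoids t (on-line-through-common-points (factor t) M x≢y x∈L y∈L x∈M y∈M A∈M)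

    factor-through-two-of : (f : Fin (suc n) → Fin (dim n)) → (∀ s → f s ≢ A) →
      ¬ ¬ (∃ λ t → ∃₂ λ s s' → s ≢ s' × OnLine (factor t) (X (f s)) × OnLine (factor t) (X (f s')))
    factor-through-two-of f f≢A = ¬¬-map collide (¬¬-pull-Fin (λ s → covers (f s) (f≢A s)))
      where
      collide : (∀ s → ∃ λ t → OnLine (factor t) (X (f s))) →
                ∃ λ t → ∃₂ λ s s' → s ≢ s' × OnLine (factor t) (X (f s)) × OnLine (factor t) (X (f s'))
      collide w =
        let (s , s' , s<s' , same) = pigeonhole (n<1+n n) (proj₁ ∘ w)
        in proj₁ (w s) , s , s' , <⇒≢ s<s' , proj₂ (w s) ,
           subst (λ t → OnLine (factor t) (X (f s'))) (sym same) (proj₂ (w s'))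

    maximal-line-is-factor : ∀ M → Maximal n X M → ¬ OnLine M (X A) → ¬ ¬ (∃ λ u → SameLine M (factor u))
    maximal-line-is-factor M (f , f-injective , f∈M) A∉M =
      ¬¬-map (λ (t , s , s' , s≢s' , s∈t , s'∈t) →
               t , same-line-through-common-points M (factor t) (s≢s' ∘ f-injective ∘ X-injective)
                     (f∈M s) (f∈M s') s∈t s'∈t)
        (factor-through-two-of f (λ s fs≡A → A∉M (subst (OnLine M ∘ X) fs≡A (f∈M s))))

    record OtherNodes (M : Line) : Set where
      field
        node           : Fin n → Fin (dim n)
        node-injective : ∀ {s s'} → node s ≡ node s' → s ≡ s'
        node∈M         : ∀ s → OnLine M (X (node s))
        node≢A         : ∀ s → node s ≢ A

    otherNodes : ∀ M → Maximal n X M → OnLine M (X A) → ¬ ¬ OtherNodes M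
    otherNodes M (f , f-injective , f∈M) A∈M k with any? (λ s → f s ≟ A)
    ... | yes (s₀ , fs₀≡A) = k record
      { node           = f ∘ punchIn s₀
      ; node-injective = punchIn-injective s₀ _ _ ∘ f-injective
      ; node∈M         = f∈M ∘ punchIn s₀
      ; node≢A         = λ s e → punchInᵢ≢i s₀ s (f-injective (trans e (sym fs₀≡A)))
      }
    ... | no A∉f = factor-through-two-of f (λ s e → A∉f (s , e)) λ (t , s , s' , s≢s' , s∈t , s'∈t) →
      factor-meets-line-through-A-once M t A∈M (s≢s' ∘ f-injective ∘ X-injective) s∈t s'∈t (f∈M s) (f∈M s')

    module _ {M} (A∈M : OnLine M (X A)) (N : OtherNodes M) where
      open OtherNodes N

      on-same-factor⇒same-node : ∀ t {s s'} → OnLine (factor t) (X (node s)) → OnLine (factor t) (X (node s')) →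
                                 s ≡ s'
      on-same-factor⇒same-node t {s} {s'} s∈t s'∈t = decidable-stable (s ≟ s') λ s≢s' →
        factor-meets-line-through-A-once M t A∈M (s≢s' ∘ node-injective ∘ X-injective)
          s∈t s'∈t (node∈M s) (node∈M s')

      -- The n nodes of M other than A lie on the n factors, at most one on each, so any choice of
      -- a factor through each node is a bijection.
      module ChosenFactor (w : ∀ s → ∃ λ t → OnLine (factor t) (X (node s))) where
        chosen : Fin n → Fin n
        chosen = proj₁ ∘ w

        node∈chosen : ∀ s → OnLine (factor (chosen s)) (X (node s))
        node∈chosen = proj₂ ∘ w

        chosen-surjective : ∀ u → ∃ λ s → chosen s ≡ u
        chosen-surjective = injective⇒surjective chosen λ {s} {s'} same →
          on-same-factor⇒same-node (chosen s) (node∈chosen s)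
            (subst (λ t → OnLine (factor t) (X (node s'))) (sym same) (node∈chosen s'))

        chosen-unique : ∀ s u → OnLine (factor u) (X (node s)) → chosen s ≡ u
        chosen-unique s u s∈u =
          let (s' , s'↦u) = chosen-surjective u
              s'∈u = subst (λ t → OnLine (factor t) (X (node s'))) s'↦u (node∈chosen s')
          in trans (cong chosen (on-same-factor⇒same-node u s∈u s'∈u)) s'↦u

        node-on-chosen-factor : ∀ u → ∃ λ s → OnLine (factor u) (X (node s))
        node-on-chosen-factor u =
          let (s , s↦u) = chosen-surjective u
          in s , subst (λ t → OnLine (factor t) (X (node s))) s↦u (node∈chosen s)

      chosen-factors : ¬ ¬ (∀ s → ∃ λ t → OnLine (factor t) (X (node s)))
      chosen-factors = ¬¬-pull-Fin (λ s → covers (node s) (node≢A s))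

      factor-contains-node : ∀ u → ¬ ¬ (∃ λ s → OnLine (factor u) (X (node s)))
      factor-contains-node u = ¬¬-map (λ w → ChosenFactor.node-on-chosen-factor w u) chosen-factors

      node-on-unique-factor : ∀ s u v → OnLine (factor u) (X (node s)) → OnLine (factor v) (X (node s)) → u ≡ v
      node-on-unique-factor s u v s∈u s∈v = decidable-stable (u ≟ v) λ u≢v → chosen-factors λ w →
        u≢v (trans (sym (ChosenFactor.chosen-unique w s u s∈u)) (ChosenFactor.chosen-unique w s v s∈v))

maximal-line-count : ∀ {n} → 1 ≤ n → n ℕ.< n ℕ.+ 2 ℕ.∸ 3 ℕ.+ 2
maximal-line-count {suc n} _ = begin-strict
  suc n                 <⟨ n<1+n (suc n) ⟩
  2 ℕ.+ n               ≡⟨ ℕₚ.+-comm 2 n ⟩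
  n ℕ.+ 2               ≡⟨ cong (ℕ._+ 2) (ℕₚ.m+n∸n≡m n 2) ⟨
  n ℕ.+ 2 ℕ.∸ 2 ℕ.+ 2   ∎
  where open ℕₚ.≤-Reasoning

emb-injective : ∀ {n} (h : 4 ≤ n) {a b} → emb h a ≡ emb h b → a ≡ b
emb-injective h {a} {b} = inject≤-injective _ _ a b

module Defect3Configuration (F : RealClosedField) where
  open FieldProperties F
  open PlaneGeometry F
  open Factorisation F
  open Plane F using (Point; Line; OnLine; SameLine; Collinear; dim; GC; Injective)
  open Defect3 F

  module _ {n} {h : 4 ≤ n} {X : Fin (dim n) → Point} (X-injective : Injective X) (S : Labelling n h X) where

    O-distinct : ∀ {a b} → a ≢ b → X (O S a) ≢ X (O S b)
    O-distinct a≢b = a≢b ∘ O-inj S ∘ X-injective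

    1m-node-on-OO-line : ∀ {a b c} → Distinct3 a b c → ∀ {Z} → OneMOn S a Z → Z ≢ D S a → Z ≢ D S b →
      ¬ Collinear (X (O S a)) (X (O S b)) (X Z) → ¬ ¬ Collinear (X (O S a)) (X (O S c)) (X Z)
    1m-node-on-OO-line {a} {b} {c} abc@(a≢b , b≢c , a≢c) {Z} (Z∈λa , Z∉λ) Z≢Da Z≢Db Z∉OaOb Z∉OaOc
      with D-all S Z (emb h a) Z∈λa Z∉λ Z∉OO
      where
      Z∉OaOp : ∀ p → p ≢ a → ¬ Collinear (X (O S a)) (X (O S p)) (X Z)
      Z∉OaOp p p≢a on with distinct3-cover abc p
      ... | inj₁ p≡a        = p≢a p≡a
      ... | inj₂ (inj₁ p≡b) = Z∉OaOb (subst (λ x → Collinear (X (O S a)) (X (O S x)) (X Z)) p≡b on)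
      ... | inj₂ (inj₂ p≡c) = Z∉OaOc (subst (λ x → Collinear (X (O S a)) (X (O S x)) (X Z)) p≡c on)
      Z∉OO : ∀ a₁ a₂ → a₁ ≢ a₂ → ¬ Collinear (X (O S a₁)) (X (O S a₂)) (X Z)
      Z∉OO a₁ a₂ a₁≢a₂ on with a₁ ≟ a | a₂ ≟ a
      ... | yes a₁≡a | _ =
        Z∉OaOp a₂ (a₁≢a₂ ∘ trans a₁≡a ∘ sym)
          (subst (λ x → Collinear (X (O S x)) (X (O S a₂)) (X Z)) a₁≡a on)
      ... | no _ | yes a₂≡a =
        Z∉OaOp a₁ (a₁≢a₂ ∘ flip trans (sym a₂≡a))
          (subst (λ x → Collinear (X (O S x)) (X (O S a₁)) (X Z)) a₂≡a (collinear-swap₁₂ on))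
      ... | no a₁≢a | no a₂≢a = OO-λ S a₁ a₂ a (a₁≢a₂ , a₂≢a , a₁≢a) Z on Z∈λa
    ... | m , Z≡Dm with distinct3-cover abc m
    ... | inj₁ m≡a        = Z≢Da (trans Z≡Dm (cong (D S) m≡a))
    ... | inj₂ (inj₁ m≡b) = Z≢Db (trans Z≡Dm (cong (D S) m≡b))
    ... | inj₂ (inj₂ m≡c) = D-oneM S c (emb h a) (a≢c ∘ emb-injective h)
                              (subst (OnLine (lam S (emb h a)) ∘ X) (trans Z≡Dm (cong (D S) m≡c)) Z∈λa)

    λ-meets-OO-line-once : ∀ {a c} → a ≢ c → ∀ {Z Z'} → Z ≢ Z' →
      OnLine (lam S (emb h a)) (X Z) → OnLine (lam S (emb h a)) (X Z') →
      Collinear (X (O S a)) (X (O S c)) (X Z) → Collinear (X (O S a)) (X (O S c)) (X Z') → ⊥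
    λ-meets-OO-line-once {a} a≢c {Z} {Z'} Z≢Z' Z∈λ Z'∈λ (M , Oa∈M , Oc∈M , Z∈M) (M' , Oa∈M' , Oc∈M' , Z'∈M') =
      O-zero S a (emb h a)
        (on-line-through-common-points (lam S (emb h a)) M (Z≢Z' ∘ X-injective) Z∈λ Z'∈λ Z∈M Z'∈M Oa∈M)
      where
      Z'∈M : OnLine M (X Z')
      Z'∈M = on-line-through-common-points M M' (O-distinct a≢c) Oa∈M Oc∈M Oa∈M' Oc∈M' Z'∈M'

    module OppositeLines (gc : GC n X) {i j k} (ijk : Distinct3 i j k) {P Q}
      (P∈λᵢ : OneMOn S i P) (Q∈λⱼ : OnLine (lam S (emb h j)) (X Q))
      (P∈OᵢOₖ : Collinear (X (O S i)) (X (O S k)) (X P)) (P∉OᵢOⱼ : ¬ Collinear (X (O S i)) (X (O S j)) (X P))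
      (Q∈OⱼOₖ : Collinear (X (O S j)) (X (O S k)) (X Q))
      (P≢Dᵢ : P ≢ D S i) (Q≢Dⱼ : Q ≢ D S j) (Dₖ∈PQ : Collinear (X P) (X Q) (X (D S k))) where

      private
        Oᵢ Oⱼ Oₖ : Point
        Oᵢ = X (O S i)
        Oⱼ = X (O S j)
        Oₖ = X (O S k)
        λᵢ λⱼ : Line
        λᵢ = lam S (emb h i)
        λⱼ = lam S (emb h j)
        i≢j = proj₁ ijk
        j≢k = proj₁ (proj₂ ijk)
        i≢k = proj₂ (proj₂ ijk)

      frame-nondegenerate : det Oₖ Oᵢ Oⱼ ≢ 0#
      frame-nondegenerate Δ≡0 =
        let (M , Oᵢ∈M , Oₖ∈M , P∈M) = P∈OᵢOₖ
        in P∉OᵢOⱼ (M , Oᵢ∈M , on-line-by-det M Oₖ∈M Oᵢ∈M (O-distinct (i≢k ∘ sym)) Δ≡0 , P∈M)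

      λᵢ-λⱼ-OᵢOⱼ-concurrent : ∀ r U → OnLine λᵢ r → OnLine U Oᵢ → OnLine U Oⱼ → OnLine U r →
                              ¬ ¬ OnLine λⱼ r
      λᵢ-λⱼ-OᵢOⱼ-concurrent r U r∈λᵢ Oᵢ∈U Oⱼ∈U r∈U =
        ¬¬-map (on-line-by-det λⱼ Q∈λⱼ (D-on S j) (Q≢Dⱼ ∘ X-injective))
          (dual-pappus frame-nondegenerate configuration (P≢Dᵢ ∘ X-injective)
            (λ P≡Oᵢ → O-zero S i (emb h i) (subst (OnLine λᵢ) P≡Oᵢ (proj₁ P∈λᵢ))))
        where
        configuration : DualPappusConfiguration Oₖ Oᵢ Oⱼ (X (D S i)) (X (D S j)) (X (D S k)) (X P) (X Q) r
        configuration = record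
          { P∈OₖOᵢ  = collinear⇒det≡0 (collinear-swap₁₂ P∈OᵢOₖ)
          ; Q∈OₖOⱼ  = collinear⇒det≡0 (collinear-rotate Q∈OⱼOₖ)
          ; Oₖ∈DᵢDⱼ = collinear⇒det≡0 (DD S k i j (i≢k ∘ sym , i≢j , j≢k ∘ sym))
          ; Oᵢ∈DⱼDₖ = collinear⇒det≡0 (DD S i j k ijk)
          ; Oⱼ∈DᵢDₖ = collinear⇒det≡0 (DD S j i k (i≢j ∘ sym , i≢k , j≢k))
          ; Dₖ∈PQ   = collinear⇒det≡0 Dₖ∈PQ
          ; r∈PDᵢ   = det-≡0-on-line λᵢ (proj₁ P∈λᵢ) (D-on S i) r∈λᵢ
          ; r∈OᵢOⱼ  = det-≡0-on-line U Oᵢ∈U Oⱼ∈U r∈U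
          }

      open Covering X-injective (fundamentalLines gc P)

      MaximalLineFactor : Fin (n ℕ.+ 2 ℕ.∸ 3) → Set
      MaximalLineFactor t = t ≡ emb h i ⊎ ∃ λ u → SameLine (lam S t) (factor u)

      maximal-line-factor : ∀ t → ¬ ¬ MaximalLineFactor t
      maximal-line-factor t with t ≟ emb h i
      ... | yes t≡i = λ k → k (inj₁ t≡i)
      ... | no t≢i  = ¬¬-map inj₂ (maximal-line-is-factor (lam S t) (proj₁ (enum S) t) (proj₂ P∈λᵢ t t≢i))

      zero-node-factor : ∀ a → ¬ ¬ (∃ λ u → OnLine (factor u) (X (O S a)))
      zero-node-factor a =
        covers (O S a) (λ Oa≡P → O-zero S a (emb h i) (subst (OnLine λᵢ ∘ X) (sym Oa≡P) (proj₁ P∈λᵢ)))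

      maximal-factors-distinct : ∀ {t t'} u → t ≢ t' →
        SameLine (lam S t) (factor u) → SameLine (lam S t') (factor u) → ⊥
      maximal-factors-distinct {t} {t'} u t≢t' t≅u t'≅u = proj₁ (proj₂ (enum S)) t t' t≢t' λ p →
        (proj₂ (t'≅u p) ∘ proj₁ (t≅u p)) , (proj₂ (t≅u p) ∘ proj₁ (t'≅u p))

      zero-node-off-maximal-factor : ∀ t u a → SameLine (lam S t) (factor u) → ¬ OnLine (factor u) (X (O S a))
      zero-node-off-maximal-factor t u a t≅u Oa∈u = O-zero S a t (proj₂ (t≅u (X (O S a))) Oa∈u)

      OᵢOₖ-off-factors : ∀ u → OnLine (factor u) Oᵢ → OnLine (factor u) Oₖ → ⊥
      OᵢOₖ-off-factors u Oᵢ∈u Oₖ∈u =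
        let (M , Oᵢ∈M , Oₖ∈M , P∈M) = P∈OᵢOₖ in
        avoids u (on-line-through-common-points (factor u) M (O-distinct i≢k) Oᵢ∈u Oₖ∈u Oᵢ∈M Oₖ∈M P∈M)

      module _ (N : OtherNodes λᵢ) (λ-factor : ∀ t → MaximalLineFactor t)
               (O-factor : ∀ a → ∃ λ u → OnLine (factor u) (X (O S a))) where
        open OtherNodes N

        OⱼOₖ-off-factors : ∀ u → OnLine (factor u) Oⱼ → OnLine (factor u) Oₖ → ⊥
        OⱼOₖ-off-factors u Oⱼ∈u Oₖ∈u = factor-contains-node (proj₁ P∈λᵢ) N u λ (s , s∈u) →
          OO-λ S j k i (j≢k , i≢k ∘ sym , i≢j ∘ sym) (node s) (factor u , Oⱼ∈u , Oₖ∈u , s∈u) (node∈M s)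

        OᵢOⱼ-off-factors : ∀ u → OnLine (factor u) Oᵢ → OnLine (factor u) Oⱼ → ⊥
        OᵢOⱼ-off-factors u Oᵢ∈u Oⱼ∈u with λ-factor (emb h j)
        ... | inj₁ j≡i        = i≢j (sym (emb-injective h j≡i))
        ... | inj₂ (v , λⱼ≅v) = factor-contains-node (proj₁ P∈λᵢ) N u λ (s , s∈u) →
          λᵢ-λⱼ-OᵢOⱼ-concurrent (X (node s)) (factor u) (node∈M s) Oᵢ∈u Oⱼ∈u s∈u λ s∈λⱼ →
            let u≡v = node-on-unique-factor (proj₁ P∈λᵢ) N s u v s∈u (proj₁ (λⱼ≅v (X (node s))) s∈λⱼ)
            in zero-node-off-maximal-factor (emb h j) v i λⱼ≅v (subst (λ w → OnLine (factor w) Oᵢ) u≡v Oᵢ∈u)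

        O-slot : Fin 3 → Fin n
        O-slot = proj₁ ∘ O-factor

        O∈O-slot : ∀ a → OnLine (factor (O-slot a)) (X (O S a))
        O∈O-slot = proj₂ ∘ O-factor

        maximal-slot : ∀ {t} → MaximalLineFactor t → Fin n
        maximal-slot (inj₁ _)       = O-slot k
        maximal-slot (inj₂ (u , _)) = u

        -- The maximal lines other than λᵢ and the nodes Oᵢ, Oⱼ, Oₖ occupy n + 1 distinct factors;
        -- Oₖ takes the slot of λᵢ, which passes through P and so is not a factor.
        slot : Fin (n ℕ.+ 2 ℕ.∸ 3) ⊎ Fin 2 → Fin n
        slot (inj₁ t)          = maximal-slot (λ-factor t)
        slot (inj₂ zero)       = O-slot i
        slot (inj₂ (suc zero)) = O-slot j

        Oₖ∈ : ∀ {u} → O-slot k ≡ u → OnLine (factor u) Oₖ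
        Oₖ∈ e = subst (λ w → OnLine (factor w) Oₖ) e (O∈O-slot k)

        maximal-slot-≢-O-slot : ∀ t a → slot (inj₁ t) ≢ slot (inj₂ a)
        maximal-slot-≢-O-slot t zero e with λ-factor t
        ... | inj₁ _         = OᵢOₖ-off-factors (O-slot i) (O∈O-slot i) (Oₖ∈ e)
        ... | inj₂ (u , t≅u) =
          zero-node-off-maximal-factor t u i t≅u (subst (λ w → OnLine (factor w) Oᵢ) (sym e) (O∈O-slot i))
        maximal-slot-≢-O-slot t (suc zero) e with λ-factor t
        ... | inj₁ _         = OⱼOₖ-off-factors (O-slot j) (O∈O-slot j) (Oₖ∈ e)
        ... | inj₂ (u , t≅u) =
          zero-node-off-maximal-factor t u j t≅u (subst (λ w → OnLine (factor w) Oⱼ) (sym e) (O∈O-slot j))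

        slots-distinct : ∀ x y → x ≢ y → slot x ≢ slot y
        slots-distinct (inj₁ t) (inj₁ t') x≢y e with λ-factor t | λ-factor t'
        ... | inj₁ t≡i        | inj₁ t'≡i         = x≢y (cong inj₁ (trans t≡i (sym t'≡i)))
        ... | inj₁ _          | inj₂ (u' , t'≅u') = zero-node-off-maximal-factor t' u' k t'≅u' (Oₖ∈ e)
        ... | inj₂ (u , t≅u)  | inj₁ _            = zero-node-off-maximal-factor t u k t≅u (Oₖ∈ (sym e))
        ... | inj₂ (u , t≅u)  | inj₂ (u' , t'≅u') =
          maximal-factors-distinct u (x≢y ∘ cong inj₁) t≅u (subst (λ w → SameLine (lam S t') (factor w)) (sym e) t'≅u')
        slots-distinct (inj₁ t) (inj₂ a) _ e = maximal-slot-≢-O-slot t a e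
        slots-distinct (inj₂ a) (inj₁ t) _ e = maximal-slot-≢-O-slot t a (sym e)
        slots-distinct (inj₂ zero)       (inj₂ zero)       x≢y _ = x≢y refl
        slots-distinct (inj₂ zero)       (inj₂ (suc zero)) _   e =
          OᵢOⱼ-off-factors (O-slot i) (O∈O-slot i) (subst (λ w → OnLine (factor w) Oⱼ) (sym e) (O∈O-slot j))
        slots-distinct (inj₂ (suc zero)) (inj₂ zero)       _   e =
          OᵢOⱼ-off-factors (O-slot i) (O∈O-slot i) (subst (λ w → OnLine (factor w) Oⱼ) e (O∈O-slot j))
        slots-distinct (inj₂ (suc zero)) (inj₂ (suc zero)) x≢y _ = x≢y refl

        too-many-slots : ⊥
        too-many-slots = no-injection-⊎ (maximal-line-count (≤-trans (s≤s z≤n) h)) slot λ {x} {y} e →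
          decidable-stable (Sum.≡-dec _≟_ _≟_ x y) λ x≢y → slots-distinct x y x≢y e

      impossible : ⊥
      impossible =
        otherNodes λᵢ (proj₁ (enum S) (emb h i)) (proj₁ P∈λᵢ) λ N →
        ¬¬-pull-Fin maximal-line-factor λ λ-factor →
        ¬¬-pull-Fin zero-node-factor λ O-factor →
        too-many-slots N λ-factor O-factor

mainTheorem5 : (F : RealClosedField) → (n : ℕ) → (h : 4 ≤ n) →
    (X : Fin (Plane.dim F n) → Plane.Point F) → Plane.GC F n X →
    (S : Defect3.Labelling F n h X) →
    ∀ i j k → Defect3.Distinct3 F i j k →
    ∀ P Q → P ≢ Q →
    (Defect3.OneMOn F S i P ⊎ Defect3.OneMOn F S j P) →
    (Defect3.OneMOn F S i Q ⊎ Defect3.OneMOn F S j Q) →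
    ¬ Plane.Collinear F (X (Defect3.O S i)) (X (Defect3.O S j)) (X P) →
    ¬ Plane.Collinear F (X (Defect3.O S i)) (X (Defect3.O S j)) (X Q) →
    P ≢ Defect3.D S i → P ≢ Defect3.D S j →
    Q ≢ Defect3.D S i → Q ≢ Defect3.D S j →
    ¬ Plane.Collinear F (X P) (X Q) (X (Defect3.D S k))
mainTheorem5 F n h X gc S i j k ijk@(i≢j , j≢k , i≢k) P Q P≢Q P-on Q-on
             P∉OᵢOⱼ Q∉OᵢOⱼ P≢Dᵢ P≢Dⱼ Q≢Dᵢ Q≢Dⱼ Dₖ∈PQ = cases P-on Q-on
  where
  open PlaneGeometry F using (collinear-swap₁₂)
  open Defect3 F using (OneMOn; Distinct3)
  open Defect3Configuration F
  X-injective = proj₁ (proj₁ gc)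
  jik : Distinct3 j i k
  jik = i≢j ∘ sym , i≢k , j≢k
  P∉OⱼOᵢ = P∉OᵢOⱼ ∘ collinear-swap₁₂
  Q∉OⱼOᵢ = Q∉OᵢOⱼ ∘ collinear-swap₁₂
  cases : (OneMOn S i P ⊎ OneMOn S j P) → (OneMOn S i Q ⊎ OneMOn S j Q) → ⊥
  cases (inj₁ P∈λᵢ) (inj₂ Q∈λⱼ) =
    1m-node-on-OO-line X-injective S ijk P∈λᵢ P≢Dᵢ P≢Dⱼ P∉OᵢOⱼ λ P∈OᵢOₖ →
    1m-node-on-OO-line X-injective S jik Q∈λⱼ Q≢Dⱼ Q≢Dᵢ Q∉OⱼOᵢ λ Q∈OⱼOₖ →
    OppositeLines.impossible X-injective S gc ijk P∈λᵢ (proj₁ Q∈λⱼ) P∈OᵢOₖ P∉OᵢOⱼ Q∈OⱼOₖ P≢Dᵢ Q≢Dⱼ Dₖ∈PQ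
  cases (inj₂ P∈λⱼ) (inj₁ Q∈λᵢ) =
    1m-node-on-OO-line X-injective S jik P∈λⱼ P≢Dⱼ P≢Dᵢ P∉OⱼOᵢ λ P∈OⱼOₖ →
    1m-node-on-OO-line X-injective S ijk Q∈λᵢ Q≢Dᵢ Q≢Dⱼ Q∉OᵢOⱼ λ Q∈OᵢOₖ →
    OppositeLines.impossible X-injective S gc jik P∈λⱼ (proj₁ Q∈λᵢ) P∈OⱼOₖ P∉OⱼOᵢ Q∈OᵢOₖ P≢Dⱼ Q≢Dᵢ Dₖ∈PQ
  cases (inj₁ P∈λᵢ) (inj₁ Q∈λᵢ) =
    1m-node-on-OO-line X-injective S ijk P∈λᵢ P≢Dᵢ P≢Dⱼ P∉OᵢOⱼ λ P∈OᵢOₖ →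
    1m-node-on-OO-line X-injective S ijk Q∈λᵢ Q≢Dᵢ Q≢Dⱼ Q∉OᵢOⱼ λ Q∈OᵢOₖ →
    λ-meets-OO-line-once X-injective S i≢k P≢Q (proj₁ P∈λᵢ) (proj₁ Q∈λᵢ) P∈OᵢOₖ Q∈OᵢOₖ
  cases (inj₂ P∈λⱼ) (inj₂ Q∈λⱼ) =
    1m-node-on-OO-line X-injective S jik P∈λⱼ P≢Dⱼ P≢Dᵢ P∉OⱼOᵢ λ P∈OⱼOₖ →
    1m-node-on-OO-line X-injective S jik Q∈λⱼ Q≢Dⱼ Q≢Dᵢ Q∉OⱼOᵢ λ Q∈OⱼOₖ →
    λ-meets-OO-line-once X-injective S j≢k P≢Q (proj₁ P∈λⱼ) (proj₁ Q∈λⱼ) P∈OⱼOₖ Q∈OⱼOₖ
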